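{- For any graph $G$ and any subgraph $H$ of $G$, $A_{\alpha}(G)\geq A_{\alpha}(H)$.
   Context: All graphs are finite and simple. For a graph $G$, the achromatic arboricity $A_{\alpha}(G)$ is the largest integer $k$ for which there is a surjective coloring $\varsigma\colon E(G)\to\{1,\dots,k\}$ of the edges of $G$ such that every color class $\varsigma^{ -1}(i)$ induces an acyclic subgraph (a forest), and for any two distinct colors $i\neq j$ the subgraph formed by the edges of $\varsigma^{ -1}(i)\cup\varsigma^{ -1}(j)$ contains at least one cycle. -}

module Defs where

open import Data.Nat using (ℕ; suc; _≤_)
open import Data.Fin using (Fin; zero; suc; inject₁; fromℕ)
open import Data.Product using (Σ; _×_; ∃)
open import Data.Sum using (_⊎_)
open import Relation.Binary.PropositionalEquality using (_≡_; _≢_)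
open import Relation.Nullary using (¬_)
open import Function.Definitions using (Injective; Surjective)

record Graph : Set where
  field
    nV nE : ℕ
    src tgt : Fin nE → Fin nV
    loopless : ∀ e → src e ≢ tgt e
    noMulti : ∀ e f →
      ((src e ≡ src f) × (tgt e ≡ tgt f)) ⊎ ((src e ≡ tgt f) × (tgt e ≡ src f)) →
      e ≡ f

open Graph public

Joins : (G : Graph) → Fin (nE G) → Fin (nV G) → Fin (nV G) → Set
Joins G e u v = ((src G e ≡ u) × (tgt G e ≡ v)) ⊎ ((src G e ≡ v) × (tgt G e ≡ u))

-- H is a subgraph of G (up to isomorphism): injective maps on vertices and
-- edges, compatible with incidence.
_⊆G_ : Graph → Graph → Set
H ⊆G G =
  Σ (Fin (nV H) → Fin (nV G)) λ φ →
  Σ (Fin (nE H) → Fin (nE G)) λ ψ →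
    Injective _≡_ _≡_ φ × Injective _≡_ _≡_ ψ ×
    (∀ e → Joins G (ψ e) (φ (src H e)) (φ (tgt H e)))

-- A cycle in the spanning subgraph of G with edge set {e | P e}:
-- distinct vertices v₀,…,v_{l+2} (length ≥ 3), consecutive ones (cyclically)
-- joined by an edge satisfying P.
record Cycle (G : Graph) (P : Fin (nE G) → Set) : Set where
  field
    len : ℕ
    vs : Fin (suc (suc (suc len))) → Fin (nV G)
    distinct : Injective _≡_ _≡_ vs
    step : ∀ (i : Fin (suc (suc len))) →
      Σ (Fin (nE G)) λ e → P e × Joins G e (vs (inject₁ i)) (vs (suc i))
    close : Σ (Fin (nE G)) λ e → P e × Joins G e (vs (fromℕ (suc (suc len)))) (vs zero)

Acyclic : (G : Graph) → (Fin (nE G) → Set) → Set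
Acyclic G P = ¬ Cycle G P

IsCompleteAcyclicColouring : (G : Graph) (k : ℕ) → (Fin (nE G) → Fin k) → Set
IsCompleteAcyclicColouring G k c =
  Surjective _≡_ _≡_ c ×
  (∀ i → Acyclic G (λ e → c e ≡ i)) ×
  (∀ i j → i ≢ j → Cycle G (λ e → (c e ≡ i) ⊎ (c e ≡ j)))

IsAchromaticArboricity : Graph → ℕ → Set
IsAchromaticArboricity G a =
  (Σ (Fin (nE G) → Fin a) λ c → IsCompleteAcyclicColouring G a c) ×
  (∀ k (c : Fin (nE G) → Fin k) → IsCompleteAcyclicColouring G k c → k ≤ a)

-- Colour the edges of H by a complete acyclic colouring with b colours and give
-- every other edge of G a colour of its own; every colour class of G is then a
-- forest. As long as two colour classes, one of them not used on H, have a
-- forest as union, merge them. The b colours of H stay distinct and any two of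
-- them already span a cycle inside H, so when no merge is possible the
-- colouring is a complete acyclic colouring of G with at least b colours.
-- Whether a union of classes contains a cycle is not decided here, so that last
-- step is carried out in the double-negation monad; b ≤ a is decidable, hence
-- stable under double negation.
module Submission where

open import Defs
open import Data.Nat using (ℕ; _≤_; zero; suc; z≤n; _+_)
open import Data.Nat.Properties using (≤-trans; _≤?_)
open import Data.Fin using (Fin; zero; suc; punchIn; punchOut; _↑ˡ_; splitAt; join; _≟_)
open import Data.Fin.Properties using (0≢1+n; any?; injective⇒≤; sequence)
open import Data.Fin.Properties using (punchOut-injective; punchIn-punchOut; ↑ˡ-injective; splitAt-join)
open import Data.Product using (Σ; _×_; ∃; _,_; proj₁; proj₂; curry)
import Data.Product as Product
open import Data.Sum using (_⊎_; inj₁; inj₂; [_,_]′)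
import Data.Sum as Sum
open import Data.Empty using (⊥-elim)
open import Effect.Monad using (RawMonad)
open import Relation.Binary.PropositionalEquality
open import Relation.Nullary using (¬_; yes; no)
open import Relation.Nullary.Decidable using (decidable-stable)
open import Relation.Nullary.Negation using (¬¬-Monad; ¬¬-map)
open import Function.Definitions using (Injective; Surjective)
open import Function using (_∘_; id)

module _ (G : Graph) where

  Joins-sym : ∀ {f u v} → Joins G f u v → Joins G f v u
  Joins-sym = Sum.swap

  Joins-ends : ∀ {f x y u v} → Joins G f x y → Joins G f u v →
    (x ≡ u × y ≡ v) ⊎ (x ≡ v × y ≡ u)
  Joins-ends (inj₁ (refl , refl)) (inj₁ (refl , refl)) = inj₁ (refl , refl)
  Joins-ends (inj₁ (refl , refl)) (inj₂ (refl , refl)) = inj₂ (refl , refl)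
  Joins-ends (inj₂ (refl , refl)) (inj₁ (refl , refl)) = inj₂ (refl , refl)
  Joins-ends (inj₂ (refl , refl)) (inj₂ (refl , refl)) = inj₁ (refl , refl)

  Cycle-mono : ∀ {P Q : Fin (nE G) → Set} → (∀ f → P f → Q f) → Cycle G P → Cycle G Q
  Cycle-mono {P} {Q} P⇒Q C = record
    { len = len ; vs = vs ; distinct = distinct ; step = mono-step ∘ step ; close = mono-step close }
    where
    open Cycle C
    mono-step : ∀ {x y} → (Σ (Fin (nE G)) λ f → P f × Joins G f x y) →
      Σ (Fin (nE G)) λ f → Q f × Joins G f x y
    mono-step (f , Pf , J) = f , P⇒Q f Pf , J

  single-edge-acyclic : ∀ f → Acyclic G (_≡ f)
  single-edge-acyclic f C with Cycle.step C zero | Cycle.step C (suc zero)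
  ... | _ , refl , J₀₁ | _ , refl , J₁₂ with Joins-ends J₁₂ J₀₁
  ...   | inj₁ (v₁≡v₀ , _) = 0≢1+n (sym (Cycle.distinct C v₁≡v₀))
  ...   | inj₂ (_ , v₂≡v₀) = 0≢1+n (sym (Cycle.distinct C v₂≡v₀))

TwoClasses : ∀ {E k : ℕ} → (Fin E → Fin k) → Fin k → Fin k → Fin E → Set
TwoClasses c i j f = (c f ≡ i) ⊎ (c f ≡ j)

-- Sends j to i, then closes the gap left by j.
merge-colour : ∀ {k} (i j : Fin (suc k)) → i ≢ j → Fin (suc k) → Fin k
merge-colour i j i≢j x with x ≟ j
... | yes _ = punchOut (i≢j ∘ sym)
... | no x≢j = punchOut (x≢j ∘ sym)

module _ {k} {i j : Fin (suc k)} (i≢j : i ≢ j) where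

  merge-colour-injective : ∀ {x y} → x ≢ j → y ≢ j →
    merge-colour i j i≢j x ≡ merge-colour i j i≢j y → x ≡ y
  merge-colour-injective {x} {y} x≢j y≢j eq with x ≟ j | y ≟ j
  ... | yes x≡j | _ = ⊥-elim (x≢j x≡j)
  ... | no _ | yes y≡j = ⊥-elim (y≢j y≡j)
  ... | no x≢j′ | no y≢j′ = punchOut-injective (x≢j′ ∘ sym) (y≢j′ ∘ sym) eq

  merge-colour-fibre : ∀ {x l} → merge-colour i j i≢j x ≡ l →
    x ≡ punchIn j l ⊎ (x ≡ j × i ≡ punchIn j l)
  merge-colour-fibre {x} refl with x ≟ j
  ... | yes x≡j = inj₂ (x≡j , sym (punchIn-punchOut (i≢j ∘ sym)))
  ... | no x≢j = inj₁ (sym (punchIn-punchOut (x≢j ∘ sym)))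

module Embedding (G H : Graph)
  (φ : Fin (nV H) → Fin (nV G)) (ψ : Fin (nE H) → Fin (nE G))
  (φ-injective : Injective _≡_ _≡_ φ)
  (incidence : ∀ e → Joins G (ψ e) (φ (src H e)) (φ (tgt H e))) where

  Joins-push : ∀ {e u v} → Joins H e u v → Joins G (ψ e) (φ u) (φ v)
  Joins-push {e} (inj₁ (refl , refl)) = incidence e
  Joins-push {e} (inj₂ (refl , refl)) = Joins-sym G (incidence e)

  Joins-pull : ∀ {e u v} → Joins G (ψ e) (φ u) (φ v) → Joins H e u v
  Joins-pull {e} J = Sum.map injective² injective² (Joins-ends G (incidence e) J)
    where
    injective² : ∀ {u v u′ v′} → φ u ≡ φ u′ × φ v ≡ φ v′ → u ≡ u′ × v ≡ v′
    injective² = Product.map φ-injective φ-injective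

  Image : (Fin (nE H) → Set) → Fin (nE G) → Set
  Image P f = ∃ λ e → ψ e ≡ f × P e

  Image-endpoint : ∀ {P f x y} → Image P f → Joins G f x y → ∃ λ u → φ u ≡ x
  Image-endpoint (e , refl , _) J with Joins-ends G (incidence e) J
  ... | inj₁ (φs≡x , _) = src H e , φs≡x
  ... | inj₂ (_ , φt≡x) = tgt H e , φt≡x

  Cycle-push : ∀ {P} → Cycle H P → Cycle G (Image P)
  Cycle-push {P} C = record
    { len = len ; vs = φ ∘ vs ; distinct = distinct ∘ φ-injective
    ; step = push-step ∘ step ; close = push-step close }
    where
    open Cycle C
    push-step : ∀ {u v} → (Σ (Fin (nE H)) λ e → P e × Joins H e u v) →
      Σ (Fin (nE G)) λ f → Image P f × Joins G f (φ u) (φ v)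
    push-step (e , Pe , J) = ψ e , (e , refl , Pe) , Joins-push J

  Cycle-pull : ∀ {P} → Cycle G (Image P) → Cycle H P
  Cycle-pull {P} C = record
    { len = len ; vs = proj₁ ∘ preimage
    ; distinct = λ {x} {y} eq →
        distinct (trans (sym (proj₂ (preimage x))) (trans (cong φ eq) (proj₂ (preimage y))))
    ; step = pull-step ∘ step ; close = pull-step close }
    where
    open Cycle C
    -- each vertex of the cycle is entered by an edge of the image
    entered-preimage : ∀ {x y} → (Σ (Fin (nE G)) λ f → Image P f × Joins G f x y) → ∃ λ u → φ u ≡ y
    entered-preimage (_ , img , J) = Image-endpoint img (Joins-sym G J)
    preimage : ∀ x → ∃ λ u → φ u ≡ vs x
    preimage zero = entered-preimage close
    preimage (suc x) = entered-preimage (step x)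
    pull-step : ∀ {x y} → (Σ (Fin (nE G)) λ f → Image P f × Joins G f (vs x) (vs y)) →
      Σ (Fin (nE H)) λ e → P e × Joins H e (proj₁ (preimage x)) (proj₁ (preimage y))
    pull-step {x} {y} (_ , (e , refl , Pe) , J) =
      e , Pe , Joins-pull (subst₂ (Joins G (ψ e)) (sym (proj₂ (preimage x))) (sym (proj₂ (preimage y))) J)

  module Extending (ψ-injective : Injective _≡_ _≡_ ψ)
    {b} (cH : Fin (nE H) → Fin b) (cH-complete : IsCompleteAcyclicColouring H b cH) where

    record Extension (k : ℕ) : Set where
      field
        colour : Fin (nE G) → Fin k
        lift : Fin b → Fin k
        lift-injective : Injective _≡_ _≡_ lift
        colour-ψ : ∀ e → colour (ψ e) ≡ lift (cH e)
        colour-acyclic : ∀ l → Acyclic G (λ f → colour f ≡ l)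

    open Extension

    initial-split : Fin (nE G) → Fin b ⊎ Fin (nE G)
    initial-split f with any? (λ e → ψ e ≟ f)
    ... | yes (e , _) = inj₁ (cH e)
    ... | no _ = inj₂ f

    initial-split-ψ : ∀ e → initial-split (ψ e) ≡ inj₁ (cH e)
    initial-split-ψ e with any? (λ e′ → ψ e′ ≟ ψ e)
    ... | yes (e′ , ψe′≡ψe) = cong (inj₁ ∘ cH) (ψ-injective ψe′≡ψe)
    ... | no ∄ = ⊥-elim (∄ (e , refl))

    initial-split-inj₁ : ∀ {f t} → initial-split f ≡ inj₁ t → Image (λ e → cH e ≡ t) f
    initial-split-inj₁ {f} eq with any? (λ e → ψ e ≟ f)
    initial-split-inj₁ refl | yes (e , ψe≡f) = e , ψe≡f , refl

    initial-split-inj₂ : ∀ {f f₀} → initial-split f ≡ inj₂ f₀ → f ≡ f₀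
    initial-split-inj₂ {f} eq with any? (λ e → ψ e ≟ f)
    initial-split-inj₂ refl | no _ = refl

    initial-split-acyclic : ∀ s → Acyclic G (λ f → initial-split f ≡ s)
    initial-split-acyclic (inj₁ t) =
      proj₁ (proj₂ cH-complete) t ∘ Cycle-pull ∘ Cycle-mono G (λ _ → initial-split-inj₁)
    initial-split-acyclic (inj₂ f₀) =
      single-edge-acyclic G f₀ ∘ Cycle-mono G (λ _ → initial-split-inj₂)

    initial : Extension (b + nE G)
    initial = record
      { colour = join b (nE G) ∘ initial-split
      ; lift = _↑ˡ nE G
      ; lift-injective = ↑ˡ-injective (nE G) _ _
      ; colour-ψ = cong (join b (nE G)) ∘ initial-split-ψ
      ; colour-acyclic = λ l → initial-split-acyclic (splitAt b l) ∘
          Cycle-mono G (λ f eq → trans (sym (splitAt-join b (nE G) (initial-split f))) (cong (splitAt b) eq)) }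

    Mergeable : ∀ {k} → Extension k → Fin k → Fin k → Set
    Mergeable S i j = i ≢ j × (∀ t → lift S t ≢ j) × Acyclic G (TwoClasses (colour S) i j)

    merge : ∀ {k} (S : Extension (suc k)) {i j} → Mergeable S i j → Extension k
    merge {k} S {i} {j} (i≢j , j-unlifted , union-acyclic) = record
      { colour = merged ∘ colour S
      ; lift = merged ∘ lift S
      ; lift-injective = λ {t} {s} →
          lift-injective S ∘ merge-colour-injective i≢j (j-unlifted t) (j-unlifted s)
      ; colour-ψ = cong merged ∘ colour-ψ S
      ; colour-acyclic = merged-acyclic }
      where
      merged : Fin (suc k) → Fin k
      merged = merge-colour i j i≢j
      merged-acyclic : ∀ l → Acyclic G (λ f → merged (colour S f) ≡ l)
      merged-acyclic l with punchIn j l ≟ i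
      ... | yes l′≡i = union-acyclic ∘ Cycle-mono G (λ _ →
              Sum.map (λ x≡l′ → trans x≡l′ l′≡i) proj₁ ∘ merge-colour-fibre i≢j)
      ... | no l′≢i = colour-acyclic S (punchIn j l) ∘ Cycle-mono G (λ _ →
              [ id , (λ (_ , i≡l′) → ⊥-elim (l′≢i (sym i≡l′))) ]′ ∘ merge-colour-fibre i≢j)

    module _ {k} (S : Extension k) (t₀ : Fin b) (stuck : ∀ i j → ¬ Mergeable S i j) where

      colour-ψ-class : ∀ {e t} → cH e ≡ t → colour S (ψ e) ≡ lift S t
      colour-ψ-class {e} = trans (colour-ψ S e) ∘ cong (lift S)

      lift-used : ∀ t → ∃ λ f → colour S f ≡ lift S t
      lift-used t with proj₁ cH-complete t
      ... | e , cH-e≡t = ψ e , colour-ψ-class (cH-e≡t refl)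

      -- An unused colour l could be merged into the colour of t₀.
      surjective : Surjective _≡_ _≡_ (colour S)
      surjective l with any? (λ f → colour S f ≟ l) | any? (λ t → lift S t ≟ l)
      ... | yes (f , cf≡l) | _ = f , λ { refl → cf≡l }
      ... | no _ | yes (t , refl) = Product.map₂ (λ { cf≡l refl → cf≡l }) (lift-used t)
      ... | no unused | no unlifted = ⊥-elim (stuck (lift S t₀) l
            ( curry unlifted t₀ , curry unlifted
            , colour-acyclic S (lift S t₀) ∘ Cycle-mono G (λ f →
                [ id , (λ cf≡l → ⊥-elim (unused (f , cf≡l))) ]′) ))

      two-class-cycle : ∀ i j → ¬ ¬ (i ≢ j → Cycle G (TwoClasses (colour S) i j))
      two-class-cycle i j with i ≟ j | any? (λ t → lift S t ≟ i) | any? (λ t → lift S t ≟ j)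
      ... | yes i≡j | _ | _ = λ ¬cycle → ¬cycle (λ i≢j → ⊥-elim (i≢j i≡j))
      ... | no i≢j | yes (t , refl) | yes (s , refl) = λ ¬cycle → ¬cycle λ _ →
            Cycle-mono G lifted-classes (Cycle-push (proj₂ (proj₂ cH-complete) t s (i≢j ∘ cong (lift S))))
        where
        lifted-classes : ∀ f → Image (TwoClasses cH t s) f → TwoClasses (colour S) (lift S t) (lift S s) f
        lifted-classes _ (_ , refl , e∈ts) = Sum.map colour-ψ-class colour-ψ-class e∈ts
      ... | no i≢j | no i-unlifted | _ = λ ¬cycle → stuck j i
            (i≢j ∘ sym , curry i-unlifted , λ C → ¬cycle λ _ → Cycle-mono G (λ _ → Sum.swap) C)
      ... | no i≢j | _ | no j-unlifted = λ ¬cycle → stuck i j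
            (i≢j , curry j-unlifted , λ C → ¬cycle λ _ → C)

      complete : ¬ ¬ IsCompleteAcyclicColouring G k (colour S)
      complete = ¬¬-map (λ cycles → surjective , colour-acyclic S , cycles)
        (sequence ¬¬-applicative λ i → sequence ¬¬-applicative (two-class-cycle i))
        where
        ¬¬-applicative = RawMonad.rawApplicative ¬¬-Monad

    module _ {a} (maximal : ∀ k (c : Fin (nE G) → Fin k) → IsCompleteAcyclicColouring G k c → k ≤ a)
      (t₀ : Fin b) where

      stuck⇒bounded : ∀ {k} (S : Extension k) → (∀ i j → ¬ Mergeable S i j) → ¬ ¬ (b ≤ a)
      stuck⇒bounded {k} S stuck b≰a = complete S t₀ stuck λ S-complete →
        b≰a (≤-trans (injective⇒≤ (lift-injective S)) (maximal k (colour S) S-complete))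

      bounded : ∀ k → Extension k → ¬ ¬ (b ≤ a)
      bounded zero S = stuck⇒bounded S λ ()
      bounded (suc k) S b≰a = stuck⇒bounded S (λ _ _ m → bounded k (merge S m) b≰a) b≰a

lemma3 : (G H : Graph) → H ⊆G G → (a b : ℕ) →
    IsAchromaticArboricity G a → IsAchromaticArboricity H b → b ≤ a
lemma3 G H _ a zero _ _ = z≤n
lemma3 G H (φ , ψ , φ-injective , ψ-injective , incidence) a (suc b)
  (_ , maximal) ((cH , cH-complete) , _) =
  decidable-stable (suc b ≤? a) (bounded maximal zero _ initial)
  where
  open Embedding G H φ ψ φ-injective incidence
  open Extending ψ-injective cH cH-complete
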